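{- Let $G=(V,E)$ be a graph, $f,g$ consistent $2$-colorings of $G$, and $S_1,S_2\subseteq E$ matchings with $f\langle S_1,S_2\rangle=g$ such that (i) $S_1\cap S_2=\emptyset$; (ii) $f(u)\neq f(v)$ for every $\{u,v\}\in S_1$ and $(fS_1)(u)\neq(fS_1)(v)$ for every $\{u,v\}\in S_2$; (iii) every connected component of $G'=(V,S_1\cup S_2)$ is a path. Let $(u_1,\dots,u_n)$ with $n\ge2$ be a connected component of $G'$, listed in path order (its edges are $\{u_i,u_{i+1}\}$, $1\le i<n$). If $n=2$, then $f(u_1)=g(u_2)\neq f(u_2)=g(u_1)$. If $n\ge3$, then: for all $i\in\{2,\dots,n-2\}$, $f(u_i)=g(u_i)\neq f(u_{i+1})=g(u_{i+1})$; if $\{u_1,u_2\}\in S_1$ then $f(u_1)\neq f(u_2)$ and $g(u_1)=g(u_2)$; if $\{u_1,u_2\}\in S_2$ then $f(u_1)=f(u_2)$ and $g(u_1)\neq g(u_2)$; and $f(u_1)=g(u_n)\neq g(u_1)=f(u_n)$.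
   Context: A $2$-coloring is a map $f:V\to\{1,2\}$; $f,g$ are consistent if $|f^{ -1}(i)|=|g^{ -1}(i)|$ for $i=1,2$. For a matching $S\subseteq E$, $fS(u)=f(v)$ if $\{u,v\}\in S$ and $fS(u)=f(u)$ if $u$ is covered by no edge of $S$; $f\langle S_1,S_2\rangle=(fS_1)S_2$. -}

module Defs where

open import Data.Nat using (ℕ; zero; suc; _≤_)
open import Data.Fin using (Fin) renaming (_≟_ to _≟ᶠ_)
open import Data.Fin.Properties using (any?)
open import Data.Bool using (Bool; true; false; _∨_)
open import Data.Bool.Properties renaming (_≟_ to _≟ᵇ_)
open import Data.List using (List; length; filter; allFin)
open import Data.Product using (_×_; _,_; ∃; Σ-syntax; ∃-syntax)
open import Data.Sum using (_⊎_)
open import Function.Bundles using (_⇔_)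
open import Relation.Nullary using (yes; no)
open import Relation.Binary.PropositionalEquality using (_≡_; _≢_)

record Graph (N : ℕ) : Set where
  field
    adj    : Fin N → Fin N → Bool
    sym    : ∀ u v → adj u v ≡ adj v u
    irrefl : ∀ u → adj u u ≡ false
open Graph public

-- A set of (undirected) edges on Fin N: S u v ≡ true means {u,v} ∈ S.
EdgeSet : ℕ → Set
EdgeSet N = Fin N → Fin N → Bool

IsMatching : ∀ {N} → Graph N → EdgeSet N → Set
IsMatching {N} G S =
  (∀ u v → S u v ≡ S v u) ×
  (∀ u v → S u v ≡ true → adj G u v ≡ true) ×
  (∀ u v w → S u v ≡ true → S u w ≡ true → v ≡ w)

Coloring : ℕ → Set
Coloring N = Fin N → Fin 2

countColor : ∀ {N} → Coloring N → Fin 2 → ℕ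
countColor {N} f i = length (filter (λ u → f u ≟ᶠ i) (allFin N))

Consistent : ∀ {N} → Coloring N → Coloring N → Set
Consistent f g = ∀ i → countColor f i ≡ countColor g i

applyM : ∀ {N} → Coloring N → EdgeSet N → Coloring N
applyM f S u with any? (λ v → S u v ≟ᵇ true)
... | yes (v , _) = f v
... | no _ = f u

apply2 : ∀ {N} → Coloring N → EdgeSet N → EdgeSet N → Coloring N
apply2 f S₁ S₂ = applyM (applyM f S₁) S₂

union : ∀ {N} → EdgeSet N → EdgeSet N → EdgeSet N
union S₁ S₂ u v = S₁ u v ∨ S₂ u v

-- (u 1, …, u n) (1-based, indices outside 1..n ignored) is a connected
-- component of the graph (Fin N, T) which is a path listed in path order:
-- distinct vertices, the edges of T among them are exactly {u i, u (i+1)},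
-- and the vertex set is closed under T-adjacency.
IsPathComponent : ∀ {N} → EdgeSet N → (n : ℕ) → (ℕ → Fin N) → Set
IsPathComponent {N} T n u =
  (∀ i j → 1 ≤ i → i ≤ n → 1 ≤ j → j ≤ n → u i ≡ u j → i ≡ j) ×
  (∀ i j → 1 ≤ i → i ≤ n → 1 ≤ j → j ≤ n →
     (T (u i) (u j) ≡ true ⇔ (j ≡ suc i ⊎ i ≡ suc j))) ×
  (∀ i (x : Fin N) → 1 ≤ i → i ≤ n → T (u i) x ≡ true →
     ∃[ j ] (1 ≤ j × j ≤ n × u j ≡ x))

AllComponentsPaths : ∀ {N} → EdgeSet N → Set
AllComponentsPaths {N} T =
  ∀ (x : Fin N) → ∃[ n ] Σ[ u ∈ (ℕ → Fin N) ]
    (IsPathComponent T n u × ∃[ i ] (1 ≤ i × i ≤ n × u i ≡ x))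

-- Write c = f S₁, so that g = c S₂. A vertex matched by S₁ has f ≠ c and an unmatched one
-- has f = c; likewise for g and S₂. The colouring c is proper on S₁ ∪ S₂, so it alternates
-- along the path, and consecutive path edges lie in different matchings. Hence every
-- interior vertex is matched by both, which gives f = g ≠ c there, while each end vertex is
-- matched only by the matching of its edge. Inductively along the path, c at the far end
-- of an edge in S₁ (resp. S₂) is f(u₁) (resp. g(u₁)), which at u_n gives the end colours.
module Submission where

open import Defs hiding (sym)
open import Data.Nat using (ℕ; zero; suc; _≤_; _∸_; z≤n; s≤s)
open import Data.Nat.Properties using (<⇒≤; ≤-refl; n≮n)
open import Data.Fin using (Fin) renaming (zero to fzero; suc to fsuc)
open import Data.Fin.Properties using (any?)
open import Data.Bool using (true; false)
open import Data.Bool.Properties using () renaming (_≟_ to _≟ᵇ_)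
open import Data.Product using (_×_; _,_; proj₁; proj₂; Σ-syntax)
open import Data.Sum using (_⊎_; inj₁; inj₂)
open import Data.Empty using (⊥; ⊥-elim)
open import Function.Bundles using (Equivalence)
open import Relation.Nullary using (yes; no; contradiction)
open import Relation.Binary.PropositionalEquality
  using (_≡_; _≢_; refl; sym; trans; cong; cong-app; subst; ≢-sym)

≢-same⇒≡ : ∀ {a b c : Fin 2} → a ≢ b → c ≢ b → a ≡ c
≢-same⇒≡ {fzero} {fzero} a≢b _ = contradiction refl a≢b
≢-same⇒≡ {fsuc fzero} {fsuc fzero} a≢b _ = contradiction refl a≢b
≢-same⇒≡ {fzero} {fsuc fzero} {fzero} _ _ = refl
≢-same⇒≡ {fzero} {fsuc fzero} {fsuc fzero} _ c≢b = contradiction refl c≢b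
≢-same⇒≡ {fsuc fzero} {fzero} {fzero} _ c≢b = contradiction refl c≢b
≢-same⇒≡ {fsuc fzero} {fzero} {fsuc fzero} _ _ = refl

module _ {N : ℕ} where

  union-true : ∀ {S₁ S₂ : EdgeSet N} {x y} → union S₁ S₂ x y ≡ true →
               S₁ x y ≡ true ⊎ S₂ x y ≡ true
  union-true {S₁} {S₂} {x} {y} e with S₁ x y
  ... | true  = inj₁ refl
  ... | false = inj₂ e

  union-trueˡ : ∀ {S₁ S₂ : EdgeSet N} {x y} → S₁ x y ≡ true → union S₁ S₂ x y ≡ true
  union-trueˡ e rewrite e = refl

  union-trueʳ : ∀ {S₁ S₂ : EdgeSet N} {x y} → S₂ x y ≡ true → union S₁ S₂ x y ≡ true
  union-trueʳ {S₁} {S₂} {x} {y} e with S₁ x y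
  ... | true  = refl
  ... | false = e

  unmatched-if-sole : ∀ {S : EdgeSet N} {x w} → S x w ≡ false →
                      (∀ y → S x y ≡ true → y ≡ w) → ∀ y → S x y ≡ false
  unmatched-if-sole {S} {x} Sxw≡false sole y with S x y in Sxy
  ... | false = refl
  ... | true  =
    contradiction (trans (sym Sxw≡false) (subst (λ z → S x z ≡ true) (sole y Sxy) Sxy)) λ ()

  Proper : Coloring N → EdgeSet N → Set
  Proper h S = ∀ x y → S x y ≡ true → h x ≢ h y

  applyM-unmatched : ∀ (h : Coloring N) {S : EdgeSet N} {x} →
                     (∀ y → S x y ≡ false) → applyM h S x ≡ h x
  applyM-unmatched h {S} {x} unmatched with any? (λ v → S x v ≟ᵇ true)
  ... | yes (w , Sxw) = contradiction (trans (sym (unmatched w)) Sxw) λ ()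
  ... | no _ = refl

  module Matching {G : Graph N} {S : EdgeSet N} (matching : IsMatching G S) where

    matched-sym : ∀ {x y} → S x y ≡ true → S y x ≡ true
    matched-sym {x} {y} Sxy = trans (sym (proj₁ matching x y)) Sxy

    module _ (h : Coloring N) where

      applyM-matched : ∀ {x y} → S x y ≡ true → applyM h S x ≡ h y
      applyM-matched {x} {y} Sxy with any? (λ v → S x v ≟ᵇ true)
      ... | yes (w , Sxw) = cong h (proj₂ (proj₂ matching) x w y Sxw Sxy)
      ... | no none = contradiction (y , Sxy) none

      module _ (proper : Proper h S) where

        applyM-moves : ∀ {x y} → S x y ≡ true → applyM h S x ≢ h x
        applyM-moves {x} {y} Sxy e = proper x y Sxy (sym (trans (sym (applyM-matched Sxy)) e))

        applyM-proper : Proper (applyM h S) S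
        applyM-proper x y Sxy e =
          proper x y Sxy (trans (sym (applyM-matched (matched-sym Sxy)))
                                (trans (sym e) (applyM-matched Sxy)))

  module PathComponent {T : EdgeSet N} {n : ℕ} {u : ℕ → Fin N} (path : IsPathComponent T n u) where

    path-edge : ∀ {k} → suc (suc k) ≤ n → T (u (suc k)) (u (suc (suc k))) ≡ true
    path-edge q = Equivalence.from (proj₁ (proj₂ path) _ _ (s≤s z≤n) (<⇒≤ q) (s≤s z≤n) q)
                                   (inj₁ refl)

    path-neighbour : ∀ {i y} → 1 ≤ i → i ≤ n → T (u i) y ≡ true →
                     Σ[ j ∈ ℕ ] (u j ≡ y × 1 ≤ j × j ≤ n × (j ≡ suc i ⊎ i ≡ suc j))
    path-neighbour {i} {y} p q Tuy with proj₂ (proj₂ path) i y p q Tuy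
    ... | j , p′ , q′ , uj≡y =
      j , uj≡y , p′ , q′ ,
      Equivalence.to (proj₁ (proj₂ path) i j p q p′ q′)
                     (subst (λ z → T (u i) z ≡ true) (sym uj≡y) Tuy)

    path-start-neighbour : ∀ {y} → 2 ≤ n → T (u 1) y ≡ true → y ≡ u 2
    path-start-neighbour 2≤n Tuy with path-neighbour (s≤s z≤n) (<⇒≤ 2≤n) Tuy
    ... | _ , uj≡y , _ , _ , inj₁ refl = sym uj≡y
    ... | zero , _ , () , _ , inj₂ _

    module _ {G : Graph N} {S : EdgeSet N} (matching : IsMatching G S) where

      matching-path-consecutive : ∀ {k} → suc (suc (suc k)) ≤ n →
        S (u (suc k)) (u (suc (suc k))) ≡ true →
        S (u (suc (suc k))) (u (suc (suc (suc k)))) ≡ true → ⊥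
      matching-path-consecutive q Se Se′
        with proj₁ path _ _ (s≤s z≤n) (<⇒≤ (<⇒≤ q)) (s≤s z≤n) q
               (proj₂ (proj₂ matching) _ _ _ (Matching.matched-sym {G = G} matching Se) Se′)
      ... | ()

  path-end-neighbour : ∀ {T : EdgeSet N} {m u y} → IsPathComponent T (suc (suc m)) u →
                       T (u (suc (suc m))) y ≡ true → y ≡ u (suc m)
  path-end-neighbour {T} path Tuy
    with PathComponent.path-neighbour {T = T} path (s≤s z≤n) ≤-refl Tuy
  ... | _ , _ , _ , q , inj₁ refl = contradiction q (n≮n _)
  ... | _ , uj≡y , _ , _ , inj₂ refl = sym uj≡y

module Recolouring {N : ℕ} {G : Graph N} (f g : Coloring N) (S₁ S₂ : EdgeSet N)
    (m₁ : IsMatching G S₁) (m₂ : IsMatching G S₂) (f⟨S₁,S₂⟩≡g : apply2 f S₁ S₂ ≡ g)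
    (disjoint : ∀ x y → S₁ x y ≡ true → S₂ x y ≡ false)
    (f-proper : Proper f S₁) (fS₁-proper : Proper (applyM f S₁) S₂)
    (m : ℕ) (u : ℕ → Fin N) (path : IsPathComponent (union S₁ S₂) (suc (suc m)) u) where

  module M₁ = Matching {G = G} m₁
  module M₂ = Matching {G = G} m₂
  open PathComponent {T = union S₁ S₂} path

  n : ℕ
  n = suc (suc m)

  c : Coloring N
  c = applyM f S₁

  g≡cS₂ : ∀ x → g x ≡ applyM c S₂ x
  g≡cS₂ = cong-app (sym f⟨S₁,S₂⟩≡g)

  disjoint-absurd : ∀ {x y} → S₁ x y ≡ true → S₂ x y ≡ true → ⊥
  disjoint-absurd e₁ e₂ = contradiction (trans (sym (disjoint _ _ e₁)) e₂) λ ()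

  S₂⇒¬S₁ : ∀ {x y} → S₂ x y ≡ true → S₁ x y ≡ false
  S₂⇒¬S₁ {x} {y} e₂ with S₁ x y in e₁
  ... | false = refl
  ... | true  = ⊥-elim (disjoint-absurd e₁ e₂)

  f≢c : ∀ {x y} → S₁ x y ≡ true → f x ≢ c x
  f≢c e = ≢-sym (M₁.applyM-moves f f-proper e)

  f≡c : ∀ {x} → (∀ y → S₁ x y ≡ false) → f x ≡ c x
  f≡c unmatched = sym (applyM-unmatched f unmatched)

  g≢c : ∀ {x y} → S₂ x y ≡ true → g x ≢ c x
  g≢c e = subst (_≢ c _) (sym (g≡cS₂ _)) (M₂.applyM-moves c fS₁-proper e)

  g≡c : ∀ {x} → (∀ y → S₂ x y ≡ false) → g x ≡ c x
  g≡c unmatched = trans (g≡cS₂ _) (applyM-unmatched c unmatched)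

  c-proper : Proper c (union S₁ S₂)
  c-proper x y e with union-true {S₁ = S₁} {S₂ = S₂} e
  ... | inj₁ e₁ = M₁.applyM-proper f f-proper x y e₁
  ... | inj₂ e₂ = fS₁-proper x y e₂

  edge_∈_ : ℕ → EdgeSet N → Set
  edge k ∈ S = S (u (suc k)) (u (suc (suc k))) ≡ true

  path-edge-in : ∀ {k} → suc (suc k) ≤ n → edge k ∈ S₁ ⊎ edge k ∈ S₂
  path-edge-in q = union-true {S₁ = S₁} {S₂ = S₂} (path-edge q)

  c-path-edge : ∀ {k} → suc (suc k) ≤ n → c (u (suc k)) ≢ c (u (suc (suc k)))
  c-path-edge q = c-proper _ _ (path-edge q)

  alternate : ∀ {k} → suc (suc (suc k)) ≤ n →
              (edge k ∈ S₁ × edge suc k ∈ S₂) ⊎ (edge k ∈ S₂ × edge suc k ∈ S₁)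
  alternate q with path-edge-in (<⇒≤ q) | path-edge-in q
  ... | inj₁ e | inj₂ e′ = inj₁ (e , e′)
  ... | inj₂ e | inj₁ e′ = inj₂ (e , e′)
  ... | inj₁ e | inj₁ e′ = ⊥-elim (matching-path-consecutive {G = G} m₁ q e e′)
  ... | inj₂ e | inj₂ e′ = ⊥-elim (matching-path-consecutive {G = G} m₂ q e e′)

  interior-matched-twice : ∀ {k} → suc (suc (suc k)) ≤ n →
    f (u (suc (suc k))) ≢ c (u (suc (suc k))) × g (u (suc (suc k))) ≢ c (u (suc (suc k)))
  interior-matched-twice q with alternate q
  ... | inj₁ (e₁ , e₂) = f≢c (M₁.matched-sym e₁) , g≢c e₂
  ... | inj₂ (e₂ , e₁) = f≢c e₁ , g≢c (M₂.matched-sym e₂)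

  interior-colours : ∀ {k} → suc (suc (suc k)) ≤ n →
    f (u (suc (suc k))) ≡ c (u (suc k)) × g (u (suc (suc k))) ≡ c (u (suc k))
  interior-colours {k} q =
    ≢-same⇒≡ (proj₁ (interior-matched-twice q)) c≢ ,
    ≢-same⇒≡ (proj₂ (interior-matched-twice q)) c≢
    where
    c≢ : c (u (suc k)) ≢ c (u (suc (suc k)))
    c≢ = c-path-edge (<⇒≤ q)

  start-unmatched₂ : edge 0 ∈ S₁ → ∀ y → S₂ (u 1) y ≡ false
  start-unmatched₂ e = unmatched-if-sole {S = S₂} (disjoint _ _ e)
    λ _ e₂ → path-start-neighbour (s≤s (s≤s z≤n)) (union-trueʳ {S₁ = S₁} {S₂ = S₂} e₂)

  start-unmatched₁ : edge 0 ∈ S₂ → ∀ y → S₁ (u 1) y ≡ false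
  start-unmatched₁ e = unmatched-if-sole {S = S₁} (S₂⇒¬S₁ e)
    λ _ e₁ → path-start-neighbour (s≤s (s≤s z≤n)) (union-trueˡ {S₁ = S₁} {S₂ = S₂} e₁)

  end-unmatched₂ : edge m ∈ S₁ → ∀ y → S₂ (u n) y ≡ false
  end-unmatched₂ e = unmatched-if-sole {S = S₂} (disjoint _ _ (M₁.matched-sym e))
    λ _ e₂ → path-end-neighbour {T = union S₁ S₂} path (union-trueʳ {S₁ = S₁} {S₂ = S₂} e₂)

  end-unmatched₁ : edge m ∈ S₂ → ∀ y → S₁ (u n) y ≡ false
  end-unmatched₁ e = unmatched-if-sole {S = S₁} (S₂⇒¬S₁ (M₂.matched-sym e))
    λ _ e₁ → path-end-neighbour {T = union S₁ S₂} path (union-trueˡ {S₁ = S₁} {S₂ = S₂} e₁)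

  start-f≢g : f (u 1) ≢ g (u 1)
  start-f≢g with path-edge-in {k = 0} (s≤s (s≤s z≤n))
  ... | inj₁ e = λ f≡g → f≢c e (trans f≡g (g≡c (start-unmatched₂ e)))
  ... | inj₂ e = λ f≡g → g≢c e (trans (sym f≡g) (f≡c (start-unmatched₁ e)))

  FarEndColour : ℕ → Set
  FarEndColour k = (edge k ∈ S₁ → f (u 1) ≡ c (u (suc (suc k)))) ×
                   (edge k ∈ S₂ → g (u 1) ≡ c (u (suc (suc k))))

  other-colour-across : ∀ {k a b} → suc (suc (suc k)) ≤ n → a ≢ b →
                        b ≡ c (u (suc (suc k))) → a ≡ c (u (suc (suc (suc k))))
  other-colour-across q a≢b b≡c =
    ≢-same⇒≡ (λ a≡c → a≢b (trans a≡c (sym b≡c))) (≢-sym (c-path-edge q))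

  far-end-colour : ∀ k → suc (suc k) ≤ n → FarEndColour k
  far-end-colour zero _ =
    (λ e₁ → sym (M₁.applyM-matched f (M₁.matched-sym e₁))) ,
    (λ e₂ → trans (g≡cS₂ _) (M₂.applyM-matched c e₂))
  far-end-colour (suc k) q with far-end-colour k (<⇒≤ q) | alternate q
  ... | via₁ , _ | inj₁ (e₁ , e₂) =
    (λ e₁′ → ⊥-elim (disjoint-absurd e₁′ e₂)) ,
    (λ _ → other-colour-across q (≢-sym start-f≢g) (via₁ e₁))
  ... | _ , via₂ | inj₂ (e₂ , e₁) =
    (λ _ → other-colour-across q start-f≢g (via₂ e₂)) ,
    (λ e₂′ → ⊥-elim (disjoint-absurd e₁ e₂′))

  end-colours : f (u 1) ≡ g (u n) × g (u n) ≢ g (u 1) × g (u 1) ≡ f (u n)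
  end-colours with far-end-colour m ≤-refl | path-edge-in {k = m} ≤-refl
  ... | via₁ , _ | inj₁ e₁ =
    f₁≡gₙ , (λ gₙ≡g₁ → start-f≢g (trans f₁≡gₙ gₙ≡g₁)) , ≢-same⇒≡ (≢-sym start-f≢g) fₙ≢f₁
    where
    f₁≡gₙ : f (u 1) ≡ g (u n)
    f₁≡gₙ = trans (via₁ e₁) (sym (g≡c (end-unmatched₂ e₁)))
    fₙ≢f₁ : f (u n) ≢ f (u 1)
    fₙ≢f₁ fₙ≡f₁ = f≢c (M₁.matched-sym e₁) (trans fₙ≡f₁ (via₁ e₁))
  ... | _ , via₂ | inj₂ e₂ =
    ≢-same⇒≡ start-f≢g gₙ≢g₁ , gₙ≢g₁ , trans (via₂ e₂) (sym (f≡c (end-unmatched₁ e₂)))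
    where
    gₙ≢g₁ : g (u n) ≢ g (u 1)
    gₙ≢g₁ gₙ≡g₁ = g≢c (M₂.matched-sym e₂) (trans gₙ≡g₁ (via₂ e₂))

  start-in-S₁ : 3 ≤ n → edge 0 ∈ S₁ → f (u 1) ≢ f (u 2) × g (u 1) ≡ g (u 2)
  start-in-S₁ q e =
    f-proper _ _ e , trans (g≡c (start-unmatched₂ e)) (sym (proj₂ (interior-colours q)))

  start-in-S₂ : 3 ≤ n → edge 0 ∈ S₂ → f (u 1) ≡ f (u 2) × g (u 1) ≢ g (u 2)
  start-in-S₂ q e =
    trans (f≡c (start-unmatched₁ e)) (sym (proj₁ (interior-colours q))) ,
    λ g₁≡g₂ → g≢c e (trans g₁≡g₂ (proj₂ (interior-colours q)))

  interior-pair : ∀ {j} → suc (suc j) ≤ m →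
    f (u (suc (suc j))) ≡ g (u (suc (suc j))) ×
    g (u (suc (suc j))) ≢ f (u (suc (suc (suc j)))) ×
    f (u (suc (suc (suc j)))) ≡ g (u (suc (suc (suc j))))
  interior-pair {j} q =
    trans f₂ (sym g₂) ,
    (λ g≡f → c-path-edge (<⇒≤ q′) (trans (sym g₂) (trans g≡f f₃))) ,
    trans f₃ (sym g₃)
    where
    q′ : suc (suc (suc j)) ≤ n
    q′ = s≤s (s≤s (<⇒≤ q))
    f₂ = proj₁ (interior-colours q′)
    g₂ = proj₂ (interior-colours q′)
    f₃ = proj₁ (interior-colours {k = suc j} (s≤s (s≤s q)))
    g₃ = proj₂ (interior-colours {k = suc j} (s≤s (s≤s q)))

lemma7 : ∀ {N : ℕ} (G : Graph N) (f g : Coloring N) (S₁ S₂ : EdgeSet N) →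
    Consistent f g →
    IsMatching G S₁ → IsMatching G S₂ →
    apply2 f S₁ S₂ ≡ g →
    (∀ u v → S₁ u v ≡ true → S₂ u v ≡ false) →
    (∀ u v → S₁ u v ≡ true → f u ≢ f v) →
    (∀ u v → S₂ u v ≡ true → applyM f S₁ u ≢ applyM f S₁ v) →
    AllComponentsPaths (union S₁ S₂) →
    (n : ℕ) (u : ℕ → Fin N) → 2 ≤ n → IsPathComponent (union S₁ S₂) n u →
    (n ≡ 2 → f (u 1) ≡ g (u 2) × g (u 2) ≢ f (u 2) × f (u 2) ≡ g (u 1)) ×
    (3 ≤ n →
      (∀ i → 2 ≤ i → i ≤ n ∸ 2 →
        f (u i) ≡ g (u i) × g (u i) ≢ f (u (suc i)) × f (u (suc i)) ≡ g (u (suc i))) ×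
      (S₁ (u 1) (u 2) ≡ true → f (u 1) ≢ f (u 2) × g (u 1) ≡ g (u 2)) ×
      (S₂ (u 1) (u 2) ≡ true → f (u 1) ≡ f (u 2) × g (u 1) ≢ g (u 2)) ×
      (f (u 1) ≡ g (u n) × g (u n) ≢ g (u 1) × g (u 1) ≡ f (u n)))
lemma7 G f g S₁ S₂ _ m₁ m₂ f⟨S₁,S₂⟩≡g disjoint f-proper fS₁-proper _
       (suc (suc m)) u (s≤s (s≤s z≤n)) path =
  (λ { refl → two-vertices }) ,
  λ 3≤n → (λ { _ (s≤s (s≤s z≤n)) q → interior-pair q }) ,
          start-in-S₁ 3≤n , start-in-S₂ 3≤n , end-colours
  where
  open Recolouring {G = G} f g S₁ S₂ m₁ m₂ f⟨S₁,S₂⟩≡g disjoint f-proper fS₁-proper m u path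
  two-vertices : f (u 1) ≡ g (u n) × g (u n) ≢ f (u n) × f (u n) ≡ g (u 1)
  two-vertices with end-colours
  ... | f₁≡gₙ , gₙ≢g₁ , g₁≡fₙ = f₁≡gₙ , (λ gₙ≡fₙ → gₙ≢g₁ (trans gₙ≡fₙ (sym g₁≡fₙ))) , sym g₁≡fₙ
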